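{- Let $\overrightarrow{G}$ be a 2-qBMG. Then the underlying undirected graph of $\overrightarrow{G}$ is $P_6$-free, i.e. it has no induced subgraph isomorphic to the path graph $P_6$ on six vertices.
   Context: A two-color quasi best match graph (2-qBMG) is a bipartite directed graph $\overrightarrow{G}$ (vertex set split into two color classes, every edge joining vertices of different colors) without loops and parallel edges, satisfying: (N1) if $u$ and $v$ are two independent (non-adjacent) vertices then there exist no vertices $w,t$ such that $ut, vw, tw$ are edges; (N2) (bi-transitivity) if $uv, vw, wt$ are edges then $ut$ is an edge; (N3) if $u$ and $v$ have a common out-neighbor then either every out-neighbor of $u$ is an out-neighbor of $v$ or every out-neighbor of $v$ is an out-neighbor of $u$. The underlying undirected graph of a digraph has the same vertex set and an undirected edge $\{u,v\}$ whenever $uv$ or $vu$ is a directed edge. The path graph $P_n$ is the graph on vertices $v_1,\dots,v_n$ whose only edges are $v_iv_{i+1}$, $1\le i<n$. -}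

module Defs where

open import Data.Nat using (ℕ; suc)
open import Data.Fin using (Fin; toℕ)
open import Data.Bool using (Bool)
open import Data.Product using (_×_)
open import Data.Sum using (_⊎_)
open import Relation.Nullary using (¬_)
open import Relation.Binary.PropositionalEquality using (_≡_; _≢_)
open import Function.Definitions using (Injective)

record Digraph (n : ℕ) : Set₁ where
  field
    Arc : Fin n → Fin n → Set

open Digraph public

Adj : ∀ {n} → Digraph n → Fin n → Fin n → Set
Adj G u v = Arc G u v ⊎ Arc G v u

Independent : ∀ {n} → Digraph n → Fin n → Fin n → Set
Independent G u v = u ≢ v × ¬ Adj G u v

IsBipartiteLoopless : ∀ {n} → Digraph n → (Fin n → Bool) → Set
IsBipartiteLoopless G col =
  (∀ u v → Arc G u v → col u ≢ col v) × (∀ u → ¬ Arc G u u)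

N1 : ∀ {n} → Digraph n → Set
N1 {n} G = ∀ (u v w t : Fin n) → Independent G u v →
  ¬ (Arc G u t × Arc G v w × Arc G t w)

N2 : ∀ {n} → Digraph n → Set
N2 {n} G = ∀ (u v w t : Fin n) →
  Arc G u v → Arc G v w → Arc G w t → Arc G u t

N3 : ∀ {n} → Digraph n → Set
N3 {n} G = ∀ (u v x : Fin n) → Arc G u x → Arc G v x →
  (∀ y → Arc G u y → Arc G v y) ⊎ (∀ y → Arc G v y → Arc G u y)

Is2qBMG : ∀ {n} → Digraph n → (Fin n → Bool) → Set
Is2qBMG G col = IsBipartiteLoopless G col × N1 G × N2 G × N3 G

PathAdj : Fin 6 → Fin 6 → Set
PathAdj i j = suc (toℕ i) ≡ toℕ j ⊎ suc (toℕ j) ≡ toℕ i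

record InducedP6 {n : ℕ} (G : Digraph n) : Set where
  field
    f      : Fin 6 → Fin n
    inj    : Injective _≡_ _≡_ f
    pres   : ∀ i j → PathAdj i j → Adj G (f i) (f j)
    refl'  : ∀ i j → Adj G (f i) (f j) → PathAdj i j

P6Free : ∀ {n} → Digraph n → Set
P6Free G = ¬ InducedP6 G

-- Along an induced path a - b - c - d of a digraph satisfying (N1) and (N2) the
-- orientation never runs straight through b, i.e. a → b → c is impossible: an
-- arc c → d would close a → d by bi-transitivity, and an arc d → c is excluded
-- by (N1). In an induced P₆ x₀ - … - x₅ this rule, applied at x₁, …, x₄, forces
-- the edges around x₂ x₃ to alternate, which yields an induced P₅ oriented as
-- a ← b → c ← d → e. There b and d share the out-neighbour c while each has an
-- out-neighbour the other misses, contradicting (N3).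
module Submission where

open import Defs
open import Data.Nat using (ℕ)
open import Data.Fin using (Fin; #_)
open import Data.Bool using (Bool)
open import Data.Empty using (⊥; ⊥-elim)
open import Data.Product using (_,_; proj₂)
open import Data.Sum using (inj₁; inj₂; [_,_]; swap)
open import Relation.Nullary using (¬_)
open import Relation.Binary.PropositionalEquality using (_≢_; ≢-sym; refl)

module Orientation {n : ℕ} (G : Digraph n) where

  Independent-sym : ∀ {u v} → Independent G u v → Independent G v u
  Independent-sym (u≢v , u∤v) = ≢-sym u≢v , λ adj → u∤v (swap adj)

  Adj-¬Arc⇒Arc : ∀ {u v} → Adj G u v → ¬ Arc G u v → Arc G v u
  Adj-¬Arc⇒Arc (inj₁ u→v) ¬u→v = ⊥-elim (¬u→v u→v)
  Adj-¬Arc⇒Arc (inj₂ v→u) _    = v→u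

  no-transit : N1 G → N2 G → ∀ {a b c d} →
               Independent G a d → Adj G c d → Arc G a b → Arc G b c → ⊥
  no-transit _  n2 (_ , a∤d) (inj₁ c→d) a→b b→c = a∤d (inj₁ (n2 _ _ _ _ a→b b→c c→d))
  no-transit n1 _  a∥d       (inj₂ d→c) a→b b→c = n1 _ _ _ _ a∥d (a→b , d→c , b→c)

  no-alternating-P5 : N3 G → ∀ {a b c d e} → ¬ Adj G a d → ¬ Adj G b e →
                      Arc G b a → Arc G b c → Arc G d c → Arc G d e → ⊥
  no-alternating-P5 n3 a∤d b∤e b→a b→c d→c d→e =
    [ (λ b⊆d → a∤d (inj₂ (b⊆d _ b→a))) , (λ d⊆b → b∤e (inj₁ (d⊆b _ d→e))) ]
      (n3 _ _ _ b→c d→c)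

module _ {n : ℕ} {G : Digraph n} (n1 : N1 G) (n2 : N2 G) (n3 : N3 G)
         (P : InducedP6 G) where
  open InducedP6 P
  open Orientation G

  independent : ∀ i j → i ≢ j → ¬ PathAdj i j → Independent G (f i) (f j)
  independent i j i≢j ¬i~j = (λ fi≡fj → i≢j (inj fi≡fj)) , (λ adj → ¬i~j (refl' i j adj))

  x₀ x₁ x₂ x₃ x₄ x₅ : Fin n
  x₀ = f (# 0)
  x₁ = f (# 1)
  x₂ = f (# 2)
  x₃ = f (# 3)
  x₄ = f (# 4)
  x₅ = f (# 5)

  x₀x₁ : Adj G x₀ x₁
  x₀x₁ = pres (# 0) (# 1) (inj₁ refl)
  x₁x₂ : Adj G x₁ x₂
  x₁x₂ = pres (# 1) (# 2) (inj₁ refl)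
  x₂x₃ : Adj G x₂ x₃
  x₂x₃ = pres (# 2) (# 3) (inj₁ refl)
  x₃x₄ : Adj G x₃ x₄
  x₃x₄ = pres (# 3) (# 4) (inj₁ refl)
  x₄x₅ : Adj G x₄ x₅
  x₄x₅ = pres (# 4) (# 5) (inj₁ refl)

  x₀∥x₃ : Independent G x₀ x₃
  x₀∥x₃ = independent (# 0) (# 3) (λ ()) λ { (inj₁ ()) ; (inj₂ ()) }
  x₁∥x₄ : Independent G x₁ x₄
  x₁∥x₄ = independent (# 1) (# 4) (λ ()) λ { (inj₁ ()) ; (inj₂ ()) }
  x₂∥x₅ : Independent G x₂ x₅
  x₂∥x₅ = independent (# 2) (# 5) (λ ()) λ { (inj₁ ()) ; (inj₂ ()) }

  x₂→x₃⇒⊥ : Arc G x₂ x₃ → ⊥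
  x₂→x₃⇒⊥ x₂→x₃ = no-alternating-P5 n3 (proj₂ x₁∥x₄) (proj₂ x₂∥x₅) x₂→x₁ x₂→x₃ x₄→x₃ x₄→x₅
    where
    x₂→x₁ : Arc G x₂ x₁
    x₂→x₁ = Adj-¬Arc⇒Arc x₁x₂ λ x₁→x₂ → no-transit n1 n2 x₁∥x₄ x₃x₄ x₁→x₂ x₂→x₃
    x₄→x₃ : Arc G x₄ x₃
    x₄→x₃ = Adj-¬Arc⇒Arc x₃x₄ λ x₃→x₄ → no-transit n1 n2 x₂∥x₅ x₄x₅ x₂→x₃ x₃→x₄
    x₄→x₅ : Arc G x₄ x₅
    x₄→x₅ = Adj-¬Arc⇒Arc (swap x₄x₅) λ x₅→x₄ →
      no-transit n1 n2 (Independent-sym x₂∥x₅) (swap x₂x₃) x₅→x₄ x₄→x₃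

  x₃→x₂⇒⊥ : Arc G x₃ x₂ → ⊥
  x₃→x₂⇒⊥ x₃→x₂ = no-alternating-P5 n3 (proj₂ x₀∥x₃) (proj₂ x₁∥x₄) x₁→x₀ x₁→x₂ x₃→x₂ x₃→x₄
    where
    x₁→x₂ : Arc G x₁ x₂
    x₁→x₂ = Adj-¬Arc⇒Arc (swap x₁x₂) λ x₂→x₁ →
      no-transit n1 n2 (Independent-sym x₀∥x₃) (swap x₀x₁) x₃→x₂ x₂→x₁
    x₃→x₄ : Arc G x₃ x₄
    x₃→x₄ = Adj-¬Arc⇒Arc (swap x₃x₄) λ x₄→x₃ →
      no-transit n1 n2 (Independent-sym x₁∥x₄) (swap x₁x₂) x₄→x₃ x₃→x₂
    x₁→x₀ : Arc G x₁ x₀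
    x₁→x₀ = Adj-¬Arc⇒Arc x₀x₁ λ x₀→x₁ → no-transit n1 n2 x₀∥x₃ x₂x₃ x₀→x₁ x₁→x₂

  no-induced-P6 : ⊥
  no-induced-P6 = [ x₂→x₃⇒⊥ , x₃→x₂⇒⊥ ] x₂x₃

theorem3p1 : (n : ℕ) (G : Digraph n) (col : Fin n → Bool) →
    Is2qBMG G col → P6Free G
theorem3p1 n G col (_ , n1 , n2 , n3) = no-induced-P6 n1 n2 n3
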